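{- For integers $n\ge1$ and $1\le j\le 2n+1$ define $$\alpha_{n,j}=\frac{1}{6n+1}\cdot\frac{(4n+1)!}{((2n)!)^2}\cdot\frac{\binom{2n}{j-1}}{\binom{6n}{2n+j-1}}.$$ Then $\sum_{j=1}^{2n+1}\alpha_{n,j}=1$ for all $n\ge1$. -}

module Defs where

open import Data.Nat using (ℕ; zero; suc; _+_; _*_; _∸_; _^_; _!)
open import Data.Nat.Combinatorics using (_C_)
open import Data.Integer using (+_)
open import Data.Rational using (ℚ; _/_) renaming (_+_ to _+ℚ_; 0ℚ to 0ℚ)

-- Convention: a / 0 := 0 (never used in the statement below, since all
-- denominators there are positive: 6n+1 ≥ 1, (2n)! ≥ 1, and
-- binom(6n, 2n+j-1) ≥ 1 because 2n+j-1 ≤ 4n ≤ 6n for 1 ≤ j ≤ 2n+1).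
frac : ℕ → ℕ → ℚ
frac a zero    = 0ℚ
frac a (suc b) = (+ a) / suc b

alpha : ℕ → ℕ → ℚ
alpha n j =
  frac ((4 * n + 1) ! * ((2 * n) C (j ∸ 1)))
       ((6 * n + 1) * (((2 * n) !) ^ 2) * ((6 * n) C ((2 * n + j) ∸ 1)))

sumFrom1 : ℕ → (ℕ → ℚ) → ℚ
sumFrom1 zero    f = 0ℚ
sumFrom1 (suc m) f = sumFrom1 m f +ℚ f (suc m)

-- Write m = 2n and M(b, r) = C(b+r, r) (multisets of size r from b+1 kinds).
-- The proof rests on two integer facts:
--   * term identity: for k ≤ m,
--       α_{n,k+1} = M(m, k) · M(m, m-k) / C(3m+1, m),
--     proved by multiplying both cross-products by k!(m-k)! and seeing that
--     each becomes (3m+1)!;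
--   * multiset convolution (a Vandermonde identity):
--       Σ_{k ≤ m} M(a, k) · M(b, m-k) = M(a+b+1, m),
--     proved by induction on b and m from Pascal's rule and the hockey stick.
-- With a = b = m the numerators add up to the common denominator C(3m+1, m),
-- and a small lemma about sums of fractions with a common denominator in ℚ
-- finishes the proof.
module Submission where

open import Defs
open import Data.Nat
open import Data.Nat.Properties
open import Data.Nat.Combinatorics
open import Data.Nat.DivMod using (m/n*n≡m)
open import Data.Nat.Divisibility using (_∣_)
open import Data.Nat.Tactic.RingSolver using (solve-∀)
open import Data.Sum using (inj₁; inj₂)
open import Data.Empty using (⊥-elim)
open import Relation.Binary.PropositionalEquality
open import Data.Rational as Q using (1ℚ; fromℚᵘ)
import Data.Rational.Properties as QP
import Data.Rational.Unnormalised as U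
import Data.Rational.Unnormalised.Properties as UP
import Data.Integer as Z
import Data.Integer.Properties as ZP
import Data.Integer.Tactic.RingSolver as ZS

C*factorials : ∀ n x y → x + y ≡ n → (n C x) * (x ! * y !) ≡ n !
C*factorials .(x + y) x y refl = begin
  ((x + y) C x) * (x ! * y !)
    ≡⟨ cong (_* (x ! * y !)) (nCk≡n!/k![n-k]! (m≤m+n x y)) ⟩
  ((x + y) ! / (x ! * (x + y ∸ x) !)) {{x !* (x + y ∸ x) !≢0}} * (x ! * y !)
    ≡⟨ cong (λ t → ((x + y) ! / (x ! * t !)) {{x !* t !≢0}} * (x ! * y !)) (m+n∸m≡n x y) ⟩
  ((x + y) ! / (x ! * y !)) {{x !* y !≢0}} * (x ! * y !)
    ≡⟨ m/n*n≡m {{x !* y !≢0}} x!y!∣n! ⟩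
  (x + y) ! ∎
  where
  open ≡-Reasoning
  x!y!∣n! : x ! * y ! ∣ (x + y) !
  x!y!∣n! = subst (λ t → x ! * t ! ∣ (x + y) !) (m+n∸m≡n x y) (k![n∸k]!∣n! (m≤m+n x y))

C≢0 : ∀ n x y → x + y ≡ n → n C x ≢ 0
C≢0 n x y x+y≡n C≡0 = ≢-nonZero⁻¹ (n !) {{n !≢0}}
  (trans (sym (C*factorials n x y x+y≡n)) (cong (_* (x ! * y !)) C≡0))

*≢0 : ∀ a b → a ≢ 0 → b ≢ 0 → a * b ≢ 0
*≢0 a b a≢0 b≢0 ab≡0 with m*n≡0⇒m≡0∨n≡0 a ab≡0
... | inj₁ a≡0 = a≢0 a≡0
... | inj₂ b≡0 = b≢0 b≡0

Σ≤ : ℕ → (ℕ → ℕ) → ℕ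
Σ≤ zero    h = h 0
Σ≤ (suc m) h = Σ≤ m h + h (suc m)

Σ≤-cong : ∀ m {h h′} → (∀ k → k ≤ m → h k ≡ h′ k) → Σ≤ m h ≡ Σ≤ m h′
Σ≤-cong zero    h≡h′ = h≡h′ 0 z≤n
Σ≤-cong (suc m) h≡h′ =
  cong₂ _+_ (Σ≤-cong m (λ k k≤m → h≡h′ k (m≤n⇒m≤1+n k≤m))) (h≡h′ (suc m) ≤-refl)

Σ≤-+ : ∀ m h h′ → Σ≤ m (λ k → h k + h′ k) ≡ Σ≤ m h + Σ≤ m h′
Σ≤-+ zero    h h′ = refl
Σ≤-+ (suc m) h h′ =
  trans (cong (_+ (h (suc m) + h′ (suc m))) (Σ≤-+ m h h′))
        (interchange (Σ≤ m h) (Σ≤ m h′) (h (suc m)) (h′ (suc m)))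
  where
  interchange : ∀ a b c d → a + b + (c + d) ≡ a + c + (b + d)
  interchange = solve-∀

-- M b r = C(b + r, r), the number of multisets of size r drawn from b + 1 kinds.
M : ℕ → ℕ → ℕ
M b r = (b + r) C r

M-zero : ∀ r → M 0 r ≡ 1
M-zero = nCn≡1

M-pascal : ∀ b r → M (suc b) (suc r) ≡ M (suc b) r + M b (suc r)
M-pascal b r = begin
  suc (b + suc r) C suc r       ≡⟨ cong (λ t → suc t C suc r) (+-suc b r) ⟩
  suc (suc b + r) C suc r       ≡⟨ nCk+nC[k+1]≡[n+1]C[k+1] (suc b + r) r ⟨
  (suc b + r) C r + (suc b + r) C suc r
                                ≡⟨ cong (λ t → (suc b + r) C r + t C suc r) (+-suc b r) ⟨
  M (suc b) r + M b (suc r)     ∎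
  where open ≡-Reasoning

hockey-stick : ∀ a m → Σ≤ m (M a) ≡ M (suc a) m
hockey-stick a zero    = refl
hockey-stick a (suc m) = begin
  Σ≤ m (M a) + M a (suc m)                    ≡⟨ cong (_+ M a (suc m)) (hockey-stick a m) ⟩
  suc (a + m) C m + (a + suc m) C suc m       ≡⟨ cong (λ t → suc (a + m) C m + t C suc m) (+-suc a m) ⟩
  suc (a + m) C m + suc (a + m) C suc m       ≡⟨ nCk+nC[k+1]≡[n+1]C[k+1] (suc (a + m)) m ⟩
  suc (suc (a + m)) C suc m                   ≡⟨ cong (λ t → suc t C suc m) (+-suc a m) ⟨
  M (suc a) (suc m)                           ∎
  where open ≡-Reasoning

conv : ℕ → ℕ → ℕ → ℕ
conv a b m = Σ≤ m (λ k → M a k * M b (m ∸ k))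

conv-pascal : ∀ a b m → conv a (suc b) (suc m) ≡ conv a (suc b) m + conv a b (suc m)
conv-pascal a b m = begin
  conv a (suc b) (suc m)
    ≡⟨ cong (_+ last (suc b)) (Σ≤-cong m split) ⟩
  Σ≤ m (λ k → M a k * M (suc b) (m ∸ k) + M a k * M b (suc m ∸ k)) + last (suc b)
    ≡⟨ cong₂ _+_ (Σ≤-+ m _ _) last-independent ⟩
  conv a (suc b) m + Σ≤ m (λ k → M a k * M b (suc m ∸ k)) + last b
    ≡⟨ +-assoc (conv a (suc b) m) _ _ ⟩
  conv a (suc b) m + conv a b (suc m) ∎
  where
  open ≡-Reasoning
  last : ℕ → ℕ
  last c = M a (suc m) * M c (m ∸ m)
  -- the final term is M(a, m+1) · M(c, 0) = M(a, m+1) for every c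
  last-independent : last (suc b) ≡ last b
  last-independent rewrite n∸n≡0 m = refl
  split : ∀ k → k ≤ m →
          M a k * M (suc b) (suc m ∸ k) ≡ M a k * M (suc b) (m ∸ k) + M a k * M b (suc m ∸ k)
  split k k≤m rewrite +-∸-assoc 1 k≤m =
    trans (cong (M a k *_) (M-pascal b (m ∸ k))) (*-distribˡ-+ (M a k) _ _)

conv-M : ∀ a b m → conv a b m ≡ M (suc (a + b)) m
conv-M a zero m = begin
  conv a 0 m             ≡⟨ Σ≤-cong m (λ k _ → trans (cong (M a k *_) (M-zero (m ∸ k))) (*-identityʳ (M a k))) ⟩
  Σ≤ m (M a)             ≡⟨ hockey-stick a m ⟩
  M (suc a) m            ≡⟨ cong (λ t → M (suc t) m) (+-identityʳ a) ⟨
  M (suc (a + 0)) m      ∎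
  where open ≡-Reasoning
conv-M a (suc b) zero    = refl
conv-M a (suc b) (suc m) = begin
  conv a (suc b) (suc m)                           ≡⟨ conv-pascal a b m ⟩
  conv a (suc b) m + conv a b (suc m)              ≡⟨ cong₂ _+_ (conv-M a (suc b) m) (conv-M a b (suc m)) ⟩
  M (suc (a + suc b)) m + M (suc (a + b)) (suc m)  ≡⟨ cong (λ t → M (suc (a + suc b)) m + M t (suc m)) (+-suc a b) ⟨
  M (suc (a + suc b)) m + M (a + suc b) (suc m)    ≡⟨ M-pascal (a + suc b) m ⟨
  M (suc (a + suc b)) (suc m)                      ∎
  where open ≡-Reasoning

-- Cross-multiplied by k!(m-k)!, the numerator side becomes (3m+1)!, since
-- C(m, k) k!(m-k)! = m!  and  C(3m+1, m) · m! (2m+1)! = (3m+1)!.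
numerator-scaled : ∀ m k r → k + r ≡ m →
  (suc (m + m) ! * (m C k)) * (suc (m + m + m) C m) * (k ! * r !) ≡ suc (m + m + m) !
numerator-scaled m k r k+r≡m = begin
  (A * (m C k)) * D * (k ! * r !)  ≡⟨ regroup A (m C k) D (k ! * r !) ⟩
  A * D * ((m C k) * (k ! * r !))  ≡⟨ cong (A * D *_) (C*factorials m k r k+r≡m) ⟩
  A * D * m !                      ≡⟨ regroup′ A D (m !) ⟩
  D * (m ! * A)                    ≡⟨ C*factorials (suc (m + m + m)) m (suc (m + m)) (split m) ⟩
  suc (m + m + m) !                ∎
  where
  open ≡-Reasoning
  A D : ℕ
  A = suc (m + m) !
  D = suc (m + m + m) C m
  regroup : ∀ a c d e → a * c * d * e ≡ a * d * (c * e)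
  regroup = solve-∀
  regroup′ : ∀ a d e → a * d * e ≡ d * (e * a)
  regroup′ = solve-∀
  split : ∀ m → m + suc (m + m) ≡ suc (m + m + m)
  split = solve-∀

halves : ∀ m k r → k + r ≡ m → (m + k) + (m + r) ≡ m + m + m
halves m k r k+r≡m = subst (λ t → (t + k) + (t + r) ≡ t + t + t) k+r≡m (sum3 k r)
  where
  sum3 : ∀ k r → (k + r + k) + (k + r + r) ≡ (k + r) + (k + r) + (k + r)
  sum3 = solve-∀

-- Likewise the denominator side: M(m, k) · k! · m! = (m+k)!, M(m, r) · r! · m! = (m+r)!,
-- and (m+k)! (m+r)! · C(3m, m+k) · (3m+1) = (3m+1)!.
denominator-scaled : ∀ m k r → k + r ≡ m →
  (M m k * M m r) * (suc (m + m + m) * ((m !) ^ 2) * ((m + m + m) C (m + k))) * (k ! * r !)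
  ≡ suc (m + m + m) !
denominator-scaled m k r k+r≡m = begin
  (M m k * M m r) * (suc N * ((m !) ^ 2) * B) * (k ! * r !)
    ≡⟨ regroup (M m k) (M m r) (suc N) (m !) B (k !) (r !) ⟩
  suc N * B * ((M m k * (k ! * m !)) * (M m r * (r ! * m !)))
    ≡⟨ cong₂ (λ s t → suc N * B * (s * t)) (C*factorials (m + k) k m (+-comm k m))
                                            (C*factorials (m + r) r m (+-comm r m)) ⟩
  suc N * B * ((m + k) ! * (m + r) !)
    ≡⟨ *-assoc (suc N) B _ ⟩
  suc N * (B * ((m + k) ! * (m + r) !))
    ≡⟨ cong (suc N *_) (C*factorials N (m + k) (m + r) (halves m k r k+r≡m)) ⟩
  suc N !  ∎
  where
  open ≡-Reasoning
  N B : ℕ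
  N = m + m + m
  B = N C (m + k)
  regroup : ∀ c d s f b x y → c * d * (s * (f * (f * 1)) * b) * (x * y)
                              ≡ s * b * ((c * (x * f)) * (d * (y * f)))
  regroup = solve-∀

-- Both sides equal (3m+1)! after multiplication by k!(m-k)!, which is nonzero.
term-identity : ∀ m k → k ≤ m →
  (suc (m + m) ! * (m C k)) * (suc (m + m + m) C m)
  ≡ (M m k * M m (m ∸ k)) * (suc (m + m + m) * ((m !) ^ 2) * ((m + m + m) C (m + k)))
term-identity m k k≤m =
  *-cancelʳ-≡ _ _ (k ! * (m ∸ k) !) {{k !* (m ∸ k) !≢0}}
    (trans (numerator-scaled m k (m ∸ k) k+r≡m) (sym (denominator-scaled m k (m ∸ k) k+r≡m)))
  where
  k+r≡m : k + (m ∸ k) ≡ m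
  k+r≡m = m+[n∸m]≡n k≤m

-- frac a (suc e) is, by definition, the normalisation of the unnormalised a / (e+1).
unnormalised : ℕ → ℕ → U.ℚᵘ
unnormalised a e = U.mkℚᵘ (Z.+ a) e

frac-cross : ∀ a b c d → b ≢ 0 → d ≢ 0 → a * d ≡ c * b → frac a b ≡ frac c d
frac-cross a zero    c d       b≢0 _   _ = ⊥-elim (b≢0 refl)
frac-cross a (suc b) c zero    _   d≢0 _ = ⊥-elim (d≢0 refl)
frac-cross a (suc b) c (suc d) _   _   ad≡cb = QP.fromℚᵘ-cong {unnormalised a b} {unnormalised c d} (U.*≡* (begin
  Z.+ a Z.* Z.+ suc d  ≡⟨ ZP.pos-* a (suc d) ⟨
  Z.+ (a * suc d)      ≡⟨ cong Z.+_ ad≡cb ⟩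
  Z.+ (c * suc b)      ≡⟨ ZP.pos-* c (suc b) ⟩
  Z.+ c Z.* Z.+ suc b  ∎))
  where open ≡-Reasoning

frac-+ : ∀ a c e → frac a (suc e) Q.+ frac c (suc e) ≡ frac (a + c) (suc e)
frac-+ a c e = QP.toℚᵘ-injective (begin
  Q.toℚᵘ (fromℚᵘ p Q.+ fromℚᵘ q)                   ≈⟨ QP.toℚᵘ-homo-+ (fromℚᵘ p) (fromℚᵘ q) ⟩
  Q.toℚᵘ (fromℚᵘ p) U.+ Q.toℚᵘ (fromℚᵘ q)          ≈⟨ UP.+-cong (QP.toℚᵘ-fromℚᵘ p) (QP.toℚᵘ-fromℚᵘ q) ⟩
  p U.+ q                                          ≈⟨ common-denominator ⟩
  unnormalised (a + c) e                           ≈⟨ QP.toℚᵘ-fromℚᵘ (unnormalised (a + c) e) ⟨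
  Q.toℚᵘ (fromℚᵘ (unnormalised (a + c) e))         ∎)
  where
  open UP.≃-Reasoning
  p q : U.ℚᵘ
  p = unnormalised a e
  q = unnormalised c e
  distribute : ∀ x y z → (x Z.* z Z.+ y Z.* z) Z.* z ≡ (x Z.+ y) Z.* (z Z.* z)
  distribute = ZS.solve-∀
  common-denominator : p U.+ q U.≃ unnormalised (a + c) e
  common-denominator = U.*≡* (trans (distribute (Z.+ a) (Z.+ c) (Z.+ suc e))
    (sym (cong₂ Z._*_ (ZP.pos-+ a c) (ZP.pos-* (suc e) (suc e)))))

frac-self : ∀ e → frac (suc e) (suc e) ≡ 1ℚ
frac-self e = frac-cross (suc e) (suc e) 1 1 (λ ()) (λ ()) (*-comm (suc e) 1)

sumFrom1-frac : ∀ m f c e → (∀ k → k ≤ m → f (suc k) ≡ frac (c k) (suc e)) →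
                sumFrom1 (suc m) f ≡ frac (Σ≤ m c) (suc e)
sumFrom1-frac zero    f c e f≡ = trans (QP.+-identityˡ (f 1)) (f≡ 0 z≤n)
sumFrom1-frac (suc m) f c e f≡ =
  trans (cong₂ Q._+_ (sumFrom1-frac m f c e (λ k k≤m → f≡ k (m≤n⇒m≤1+n k≤m))) (f≡ (suc m) ≤-refl))
        (frac-+ (Σ≤ m c) (c (suc m)) e)

sumFrom1-frac-one : ∀ m f c D → D ≢ 0 → Σ≤ m c ≡ D →
                    (∀ k → k ≤ m → f (suc k) ≡ frac (c k) D) → sumFrom1 (suc m) f ≡ 1ℚ
sumFrom1-frac-one m f c zero    D≢0 _   _  = ⊥-elim (D≢0 refl)
sumFrom1-frac-one m f c (suc e) _   Σ≡D f≡ =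
  trans (sumFrom1-frac m f c e f≡) (trans (cong (λ t → frac t (suc e)) Σ≡D) (frac-self e))

module _ (n : ℕ) where
  private
    m : ℕ
    m = 2 * n

  numerator : ℕ → ℕ
  numerator k = M m k * M m (m ∸ k)

  denominator : ℕ
  denominator = suc (m + m + m) C m

  denominator≢0 : denominator ≢ 0
  denominator≢0 = C≢0 (suc (m + m + m)) m (suc (m + m)) (split m)
    where
    split : ∀ m → m + suc (m + m) ≡ suc (m + m + m)
    split = solve-∀

  alpha-in-m : ∀ k → alpha n (suc k)
    ≡ frac (suc (m + m) ! * (m C k)) (suc (m + m + m) * ((m !) ^ 2) * ((m + m + m) C (m + k)))
  alpha-in-m k = cong₂ frac (cong (λ t → t ! * (m C k)) (four n))
    (cong₂ (λ s t → s * ((m !) ^ 2) * t) (six n) (cong₂ _C_ (six′ n) (cong (_∸ 1) (+-suc m k))))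
    where
    four : ∀ n → 4 * n + 1 ≡ suc (2 * n + 2 * n)
    four = solve-∀
    six : ∀ n → 6 * n + 1 ≡ suc (2 * n + 2 * n + 2 * n)
    six = solve-∀
    six′ : ∀ n → 6 * n ≡ 2 * n + 2 * n + 2 * n
    six′ = solve-∀

  alpha-term : ∀ k → k ≤ m → alpha n (suc k) ≡ frac (numerator k) denominator
  alpha-term k k≤m =
    trans (alpha-in-m k) (frac-cross _ _ _ _ alpha-denominator≢0 denominator≢0 (term-identity m k k≤m))
    where
    m!²≢0 : (m !) ^ 2 ≢ 0
    m!²≢0 = ≢-nonZero⁻¹ _ {{m^n≢0 (m !) 2 {{m !≢0}}}}
    alpha-denominator≢0 : suc (m + m + m) * ((m !) ^ 2) * ((m + m + m) C (m + k)) ≢ 0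
    alpha-denominator≢0 = *≢0 _ ((m + m + m) C (m + k)) (*≢0 (suc (m + m + m)) _ (λ ()) m!²≢0)
      (C≢0 (m + m + m) (m + k) (m + (m ∸ k)) (halves m k (m ∸ k) (m+[n∸m]≡n k≤m)))

-- Lemma 2.2.  The numerators of the weights sum to the common denominator by the
-- multiset Vandermonde identity with a = b = m = 2n.
lemma2p2 : (n : ℕ) → 1 ≤ n → sumFrom1 (2 * n + 1) (alpha n) ≡ 1ℚ
lemma2p2 n _ = begin
  sumFrom1 (2 * n + 1) (alpha n)  ≡⟨ cong (λ t → sumFrom1 t (alpha n)) (+-comm (2 * n) 1) ⟩
  sumFrom1 (suc m) (alpha n)      ≡⟨ sumFrom1-frac-one m (alpha n) (numerator n) (denominator n)
                                       (denominator≢0 n) (conv-M m m m) (alpha-term n) ⟩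
  1ℚ                              ∎
  where
  open ≡-Reasoning
  m : ℕ
  m = 2 * n
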